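{- Let $t$ be an indeterminate, let $M_n(t)=\sum_{k=0}^n\binom{n}{k}^2t^k$, so that $\sum_{n\ge0}M_n(t)x^n=\frac{1}{\sqrt{(1+(1-t)x)^2-4x}}$, and for a positive integer $m$ define $u_m(n,t)$ by $$\left(\frac{1}{\sqrt{(1+(1-t)x)^2-4x}}\right)^m=\sum_{n\ge0}u_m(n,t)x^n$$ (equivalently, $u_m(n,t)=\sum_{i_1+\cdots+i_m=n}M_{i_1}(t)\cdots M_{i_m}(t)$). Then for all $n\ge0$, $$u_m(n,t)=\sum_{k\ge0}\binom{n+m-1}{m-1}\binom{n}{k}\frac{\prod_{j=0}^{k-1}(2n+m-1-2j)}{\prod_{j=0}^{k-1}(2k+m-1-2j)}\,t^k.$$
   Context: Empty products are equal to $1$. -}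

module Defs where

open import Data.Nat using (ℕ; zero; suc; _+_; _*_; _∸_)
open import Data.Nat.Combinatorics using (_C_)

-- Polynomials in the indeterminate t with natural-number coefficients,
-- represented by their coefficient function: p k = coefficient of t^k.
Poly : Set
Poly = ℕ → ℕ

sumTo : ℕ → (ℕ → ℕ) → ℕ
sumTo zero    f = f zero
sumTo (suc n) f = sumTo n f + f (suc n)

prodBelow : ℕ → (ℕ → ℕ) → ℕ
prodBelow zero    f = 1
prodBelow (suc k) f = prodBelow k f * f k

_⊛_ : Poly → Poly → Poly
(p ⊛ q) k = sumTo k (λ a → p a * q (k ∸ a))

onePoly : Poly
onePoly zero    = 1
onePoly (suc _) = 0

zeroPoly : Poly
zeroPoly _ = 0

M : ℕ → Poly
M n k = (n C k) * (n C k)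

-- u m n = Σ_{i_1+...+i_m = n} M_{i_1}(t) ⋯ M_{i_m}(t),
-- defined by recursion on m (m = 0: the empty product, i.e. x^0 coefficient of 1).
u : ℕ → ℕ → Poly
u zero    zero    = onePoly
u zero    (suc n) = zeroPoly
u (suc m) n k     = sumTo n (λ i → (M i ⊛ u m (n ∸ i)) k)

-- Let Δ = (1 + (1−t)x)² − 4x and θ = x d/dx. The series Δ^(−μ/2) satisfies the
-- first-order equation Δ·θF = μ((1+t)x − (1−t)²x²)·F, and this equation is compatible
-- with products: solutions for μ and ν multiply to a solution for μ + ν. Read
-- coefficientwise it is a recurrence in (n, k) that determines a solution from its
-- constant term 1, and the closed form a(x+y, x) = numer(x+y) / (denom x · denom y)
-- satisfies that recurrence: after clearing denominators it becomes a polynomial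
-- identity in x, y and μ. For μ = 1 the closed form is C(x+y, x)², so M = Σ M_n x^n is
-- a solution; hence u_m = M^m is one for μ = m, and u_m has the closed form.
module Submission where

open import Algebra.Bundles using (CommutativeSemiring)

module PowerSeries {c ℓ} (R : CommutativeSemiring c ℓ) where

  open import Data.Nat as ℕ using (ℕ; zero; suc; _∸_; _≤_; z≤n)
  import Data.Nat.Properties as ℕₚ
  open ℕₚ
    using (≤-refl; ≤-trans; n≤1+n; m+[n∸m]≡n; m∸[m∸n]≡n; m+n∸m≡n; ∸-+-assoc; +-∸-assoc; +-suc; n∸n≡0)
  open import Relation.Binary.PropositionalEquality as ≡ using (_≡_)
  open import Relation.Binary.Structures using (IsEquivalence)
  open import Algebra.Structures.Biased using (isCommutativeSemiringˡ; isCommutativeMonoidˡ)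
  open CommutativeSemiring R hiding (zero)
  open import Algebra.Properties.Semiring.Mult semiring using (_×_; ×-congʳ; ×-homo-+; ×-assoc-*; ×-comm-*)
  open import Algebra.Properties.CommutativeMonoid.Mult +-commutativeMonoid using (×-distrib-+)
  open import Algebra.Properties.CommutativeSemigroup +-commutativeSemigroup using (interchange)
  open import Relation.Binary.Reasoning.Setoid setoid

  ∑ : ℕ → (ℕ → Carrier) → Carrier
  ∑ zero    f = f zero
  ∑ (suc n) f = ∑ n f + f (suc n)

  ∑-cong : ∀ n {f g} → (∀ i → i ≤ n → f i ≈ g i) → ∑ n f ≈ ∑ n g
  ∑-cong zero    f≈g = f≈g zero z≤n
  ∑-cong (suc n) f≈g = +-cong (∑-cong n (λ i i≤n → f≈g i (≤-trans i≤n (n≤1+n n)))) (f≈g (suc n) ≤-refl)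

  ∑-zero : ∀ n {f} → (∀ i → i ≤ n → f i ≈ 0#) → ∑ n f ≈ 0#
  ∑-zero n f≈0 = trans (∑-cong n f≈0) (∑-0# n)
    where
    ∑-0# : ∀ n → ∑ n (λ _ → 0#) ≈ 0#
    ∑-0# zero    = refl
    ∑-0# (suc n) = trans (+-identityʳ _) (∑-0# n)

  ∑-+ : ∀ n f g → ∑ n (λ i → f i + g i) ≈ ∑ n f + ∑ n g
  ∑-+ zero    f g = refl
  ∑-+ (suc n) f g = trans (+-congʳ (∑-+ n f g)) (interchange _ _ _ _)

  ∑-distribˡ : ∀ n x f → x * ∑ n f ≈ ∑ n (λ i → x * f i)
  ∑-distribˡ zero    x f = refl
  ∑-distribˡ (suc n) x f = trans (distribˡ _ _ _) (+-congʳ (∑-distribˡ n x f))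

  ∑-distribʳ : ∀ n x f → ∑ n f * x ≈ ∑ n (λ i → f i * x)
  ∑-distribʳ zero    x f = refl
  ∑-distribʳ (suc n) x f = trans (distribʳ _ _ _) (+-congʳ (∑-distribʳ n x f))

  ×-distrib-∑ : ∀ m n f → m × ∑ n f ≈ ∑ n (λ i → m × f i)
  ×-distrib-∑ m zero    f = refl
  ×-distrib-∑ m (suc n) f = trans (×-distrib-+ _ _ m) (+-congʳ (×-distrib-∑ m n f))

  ∑-unfoldˡ : ∀ n f → ∑ (suc n) f ≈ f zero + ∑ n (λ i → f (suc i))
  ∑-unfoldˡ zero    f = refl
  ∑-unfoldˡ (suc n) f = trans (+-congʳ (∑-unfoldˡ n f)) (+-assoc _ _ _)

  ∑-reverse : ∀ n f → ∑ n f ≈ ∑ n (λ i → f (n ∸ i))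
  ∑-reverse zero    f = refl
  ∑-reverse (suc n) f = begin
    ∑ n f + f (suc n)                    ≈⟨ +-congʳ (∑-reverse n f) ⟩
    ∑ n (λ i → f (n ∸ i)) + f (suc n)    ≈⟨ +-comm _ _ ⟩
    f (suc n) + ∑ n (λ i → f (n ∸ i))    ≈⟨ ∑-unfoldˡ n (λ i → f (suc n ∸ i)) ⟨
    ∑ (suc n) (λ i → f (suc n ∸ i))      ∎

  ∑-triangle : ∀ n (G : ℕ → ℕ → Carrier) →
               ∑ n (λ i → ∑ i (λ a → G a i)) ≈ ∑ n (λ a → ∑ (n ∸ a) (λ b → G a (a ℕ.+ b)))
  ∑-triangle zero    G = refl
  ∑-triangle (suc n) G = begin
    ∑ n (λ i → ∑ i (λ a → G a i)) + (∑ n (λ a → G a (suc n)) + G (suc n) (suc n))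
      ≈⟨ +-congʳ (∑-triangle n G) ⟩
    ∑ n (λ a → ∑ (n ∸ a) (row a)) + (∑ n (λ a → G a (suc n)) + G (suc n) (suc n))
      ≈⟨ +-assoc _ _ _ ⟨
    (∑ n (λ a → ∑ (n ∸ a) (row a)) + ∑ n (λ a → G a (suc n))) + G (suc n) (suc n)
      ≈⟨ +-cong (sym (∑-+ n _ _)) (reflexive (≡.cong (G (suc n)) (≡.sym (ℕₚ.+-identityʳ (suc n))))) ⟩
    ∑ n (λ a → ∑ (n ∸ a) (row a) + G a (suc n)) + row (suc n) 0
      ≈⟨ +-cong (∑-cong n extend) (reflexive (≡.cong (λ m → ∑ m (row (suc n))) (≡.sym (n∸n≡0 n)))) ⟩
    ∑ n (λ a → ∑ (suc n ∸ a) (row a)) + ∑ (n ∸ n) (row (suc n))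
      ∎
    where
    row : ℕ → ℕ → Carrier
    row a b = G a (a ℕ.+ b)
    extend : ∀ a → a ≤ n → ∑ (n ∸ a) (row a) + G a (suc n) ≈ ∑ (suc n ∸ a) (row a)
    extend a a≤n = begin
      ∑ (n ∸ a) (row a) + G a (suc n)     ≈⟨ +-congˡ (reflexive (≡.cong (G a) a+[1+n∸a]≡1+n)) ⟨
      ∑ (suc (n ∸ a)) (row a)             ≡⟨ ≡.cong (λ m → ∑ m (row a)) (+-∸-assoc 1 a≤n) ⟨
      ∑ (suc n ∸ a) (row a)               ∎
      where
      a+[1+n∸a]≡1+n : a ℕ.+ suc (n ∸ a) ≡ suc n
      a+[1+n∸a]≡1+n = ≡.trans (+-suc a (n ∸ a)) (≡.cong suc (m+[n∸m]≡n a≤n))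

  S : Set c
  S = ℕ → Carrier

  infix  4 _≋_
  infixl 6 _⊕_
  infixl 7 _⋆_

  _≋_ : S → S → Set ℓ
  F ≋ G = ∀ n → F n ≈ G n

  _⊕_ : S → S → S
  (F ⊕ G) n = F n + G n

  _⋆_ : S → S → S
  (F ⋆ G) n = ∑ n (λ i → F i * G (n ∸ i))

  C : Carrier → S
  C a zero    = a
  C a (suc _) = 0#

  𝟘 𝟙 : S
  𝟘 _ = 0#
  𝟙   = C 1#

  shift : S → S
  shift F zero    = 0#
  shift F (suc n) = F n

  θ : S → S
  θ F n = n × F n

  ⋆-cong : ∀ {F F′ G G′} → F ≋ F′ → G ≋ G′ → F ⋆ G ≋ F′ ⋆ G′
  ⋆-cong F≋F′ G≋G′ n = ∑-cong n (λ i _ → *-cong (F≋F′ i) (G≋G′ (n ∸ i)))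

  ⋆-comm : ∀ F G → F ⋆ G ≋ G ⋆ F
  ⋆-comm F G n = begin
    ∑ n (λ i → F i * G (n ∸ i))               ≈⟨ ∑-reverse n _ ⟩
    ∑ n (λ i → F (n ∸ i) * G (n ∸ (n ∸ i)))
      ≈⟨ ∑-cong n (λ i i≤n → trans (*-comm _ _) (*-congʳ (reflexive (≡.cong G (m∸[m∸n]≡n i≤n))))) ⟩
    ∑ n (λ i → G i * F (n ∸ i))               ∎

  ⋆-assoc : ∀ F G H → (F ⋆ G) ⋆ H ≋ F ⋆ (G ⋆ H)
  ⋆-assoc F G H n = begin
    ∑ n (λ i → ∑ i (λ a → F a * G (i ∸ a)) * H (n ∸ i))
      ≈⟨ ∑-cong n (λ i _ → ∑-distribʳ i _ _) ⟩
    ∑ n (λ i → ∑ i (λ a → F a * G (i ∸ a) * H (n ∸ i)))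
      ≈⟨ ∑-triangle n (λ a i → F a * G (i ∸ a) * H (n ∸ i)) ⟩
    ∑ n (λ a → ∑ (n ∸ a) (λ b → F a * G (a ℕ.+ b ∸ a) * H (n ∸ (a ℕ.+ b))))
      ≈⟨ ∑-cong n (λ a _ → ∑-cong (n ∸ a) (λ b _ → trans (*-assoc _ _ _) (*-congˡ (reflexive
           (≡.cong₂ (λ i j → G i * H j) (m+n∸m≡n a b) (≡.sym (∸-+-assoc n a b))))))) ⟩
    ∑ n (λ a → ∑ (n ∸ a) (λ b → F a * (G b * H (n ∸ a ∸ b))))
      ≈⟨ ∑-cong n (λ a _ → ∑-distribˡ (n ∸ a) _ _) ⟨
    ∑ n (λ a → F a * ∑ (n ∸ a) (λ b → G b * H (n ∸ a ∸ b)))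
      ∎

  C-⋆ : ∀ a F → C a ⋆ F ≋ λ n → a * F n
  C-⋆ a F zero    = refl
  C-⋆ a F (suc n) = begin
    (C a ⋆ F) (suc n)                                  ≈⟨ ∑-unfoldˡ n _ ⟩
    a * F (suc n) + ∑ n (λ i → 0# * F (n ∸ i))         ≈⟨ +-congˡ (∑-zero n (λ i _ → zeroˡ _)) ⟩
    a * F (suc n) + 0#                                 ≈⟨ +-identityʳ _ ⟩
    a * F (suc n)                                      ∎

  shift-cong : ∀ {F G} → F ≋ G → shift F ≋ shift G
  shift-cong F≋G zero    = refl
  shift-cong F≋G (suc n) = F≋G n

  shift-⋆ : ∀ F G → shift F ⋆ G ≋ shift (F ⋆ G)
  shift-⋆ F G zero    = zeroˡ _
  shift-⋆ F G (suc n) = trans (∑-unfoldˡ n _) (trans (+-congʳ (zeroˡ _)) (+-identityˡ _))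

  ⋆-distribʳ : ∀ H F G → (F ⊕ G) ⋆ H ≋ F ⋆ H ⊕ G ⋆ H
  ⋆-distribʳ H F G n = trans (∑-cong n (λ i _ → distribʳ _ _ _)) (∑-+ n _ _)

  ≋-isEquivalence : IsEquivalence _≋_
  ≋-isEquivalence = record
    { refl  = λ _ → refl
    ; sym   = λ F≋G n → sym (F≋G n)
    ; trans = λ F≋G G≋H n → trans (F≋G n) (G≋H n)
    }

  commutativeSemiring : CommutativeSemiring c ℓ
  commutativeSemiring = record
    { Carrier = S ; _≈_ = _≋_ ; _+_ = _⊕_ ; _*_ = _⋆_ ; 0# = 𝟘 ; 1# = 𝟙
    ; isCommutativeSemiring = isCommutativeSemiringˡ record
      { +-isCommutativeMonoid = isCommutativeMonoidˡ record
        { isSemigroup = record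
          { isMagma = record { isEquivalence = ≋-isEquivalence ; ∙-cong = λ F≋F′ G≋G′ n → +-cong (F≋F′ n) (G≋G′ n) }
          ; assoc   = λ F G H n → +-assoc _ _ _ }
        ; identityˡ = λ F n → +-identityˡ _
        ; comm      = λ F G n → +-comm _ _ }
      ; *-isCommutativeMonoid = isCommutativeMonoidˡ record
        { isSemigroup = record
          { isMagma = record { isEquivalence = ≋-isEquivalence ; ∙-cong = ⋆-cong }
          ; assoc   = ⋆-assoc }
        ; identityˡ = λ F n → trans (C-⋆ 1# F n) (*-identityˡ _)
        ; comm      = ⋆-comm }
      ; distribʳ = ⋆-distribʳ
      ; zeroˡ    = λ F n → ∑-zero n (λ i _ → zeroˡ _)
      }
    }

  θ-cong : ∀ {F G} → F ≋ G → θ F ≋ θ G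
  θ-cong F≋G n = ×-congʳ n (F≋G n)

  θ-⋆ : ∀ F G → θ (F ⋆ G) ≋ θ F ⋆ G ⊕ F ⋆ θ G
  θ-⋆ F G n = begin
    n × ∑ n (λ i → F i * G (n ∸ i))                                  ≈⟨ ×-distrib-∑ n n _ ⟩
    ∑ n (λ i → n × (F i * G (n ∸ i)))                                ≈⟨ ∑-cong n leibniz ⟩
    ∑ n (λ i → (i × F i) * G (n ∸ i) + F i * ((n ∸ i) × G (n ∸ i)))  ≈⟨ ∑-+ n _ _ ⟩
    (θ F ⋆ G ⊕ F ⋆ θ G) n                                             ∎
    where
    leibniz : ∀ i → i ≤ n → n × (F i * G (n ∸ i)) ≈ (i × F i) * G (n ∸ i) + F i * ((n ∸ i) × G (n ∸ i))
    leibniz i i≤n = begin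
      n × (F i * G (n ∸ i))                                        ≡⟨ ≡.cong (_× (F i * G (n ∸ i))) (m+[n∸m]≡n i≤n) ⟨
      (i ℕ.+ (n ∸ i)) × (F i * G (n ∸ i))                          ≈⟨ ×-homo-+ _ i (n ∸ i) ⟩
      i × (F i * G (n ∸ i)) + (n ∸ i) × (F i * G (n ∸ i))          ≈⟨ +-cong (sym (×-assoc-* i _ _)) (sym (×-comm-* (n ∸ i) _ _)) ⟩
      (i × F i) * G (n ∸ i) + F i * ((n ∸ i) × G (n ∸ i))          ∎

  open import Algebra.Properties.Semiring.Mult (CommutativeSemiring.semiring commutativeSemiring)
    using () renaming (_×_ to _×ₛ_)

  ×-coeff : ∀ m F n → (m ×ₛ F) n ≈ m × F n
  ×-coeff zero    F n = refl
  ×-coeff (suc m) F n = +-congˡ (×-coeff m F n)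

-- A first-order equation compatible with products
module EulerEquation {c ℓ} (T : CommutativeSemiring c ℓ) where

  open import Data.Nat as ℕ using (ℕ)
  open CommutativeSemiring T
  open import Algebra.Properties.Semiring.Mult semiring using (_×_; ×-congʳ; ×-homo-+; ×-assoc-*; ×-comm-*)
  open import Algebra.Solver.Ring.NaturalCoefficients.Default T using (solve; _:+_; _:*_; _:=_)
  open import Relation.Binary.Reasoning.Setoid setoid

  module Equation (θ : Carrier → Carrier) (θ-cong : ∀ {a b} → a ≈ b → θ a ≈ θ b)
           (θ-* : ∀ a b → θ (a * b) ≈ θ a * b + a * θ b) (X Y Z : Carrier) where

    lhs rhs : ℕ → Carrier → Carrier
    lhs μ F = θ F + Y * (θ F + μ × F)
    rhs μ F = X * (θ F + θ F + μ × F) + Z * (θ F + μ × F)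

    Solves : ℕ → Carrier → Set ℓ
    Solves μ F = lhs μ F ≈ rhs μ F

    private
      ×-* : ∀ μ ν F G → (μ ℕ.+ ν) × (F * G) ≈ (μ × F) * G + F * (ν × G)
      ×-* μ ν F G = trans (×-homo-+ _ μ ν) (+-cong (sym (×-assoc-* μ F G)) (sym (×-comm-* ν F G)))

    lhs-* : ∀ μ ν F G → lhs (μ ℕ.+ ν) (F * G) ≈ lhs μ F * G + F * lhs ν G
    lhs-* μ ν F G = begin
      θ (F * G) + Y * (θ (F * G) + (μ ℕ.+ ν) × (F * G))
        ≈⟨ +-cong (θ-* F G) (*-congˡ (+-cong (θ-* F G) (×-* μ ν F G))) ⟩
      (θ F * G + F * θ G) + Y * ((θ F * G + F * θ G) + ((μ × F) * G + F * (ν × G)))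
        ≈⟨ solve 7 (λ a b f g y p q →
             (a :* g :+ f :* b) :+ y :* ((a :* g :+ f :* b) :+ (p :* g :+ f :* q))
             := (a :+ y :* (a :+ p)) :* g :+ f :* (b :+ y :* (b :+ q)))
             refl (θ F) (θ G) F G Y (μ × F) (ν × G) ⟩
      lhs μ F * G + F * lhs ν G
        ∎

    rhs-* : ∀ μ ν F G → rhs (μ ℕ.+ ν) (F * G) ≈ rhs μ F * G + F * rhs ν G
    rhs-* μ ν F G = begin
      X * (θ (F * G) + θ (F * G) + (μ ℕ.+ ν) × (F * G)) + Z * (θ (F * G) + (μ ℕ.+ ν) × (F * G))
        ≈⟨ +-cong (*-congˡ (+-cong (+-cong (θ-* F G) (θ-* F G)) (×-* μ ν F G)))
                  (*-congˡ (+-cong (θ-* F G) (×-* μ ν F G))) ⟩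
      X * ((θ F * G + F * θ G) + (θ F * G + F * θ G) + ((μ × F) * G + F * (ν × G)))
        + Z * ((θ F * G + F * θ G) + ((μ × F) * G + F * (ν × G)))
        ≈⟨ solve 8 (λ a b f g x z p q →
             x :* ((a :* g :+ f :* b) :+ (a :* g :+ f :* b) :+ (p :* g :+ f :* q))
               :+ z :* ((a :* g :+ f :* b) :+ (p :* g :+ f :* q))
             := (x :* (a :+ a :+ p) :+ z :* (a :+ p)) :* g :+ f :* (x :* (b :+ b :+ q) :+ z :* (b :+ q)))
             refl (θ F) (θ G) F G X Z (μ × F) (ν × G) ⟩
      rhs μ F * G + F * rhs ν G
        ∎

    solves-* : ∀ {μ ν F G} → Solves μ F → Solves ν G → Solves (μ ℕ.+ ν) (F * G)
    solves-* {μ} {ν} {F} {G} sF sG =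
      trans (lhs-* μ ν F G) (trans (+-cong (*-congʳ sF) (*-congˡ sG)) (sym (rhs-* μ ν F G)))

    solves-resp : ∀ μ {F G} → F ≈ G → Solves μ F → Solves μ G
    solves-resp μ F≈G sF = trans (sym (lhs-cong F≈G)) (trans sF (rhs-cong F≈G))
      where
      lhs-cong : ∀ {F G} → F ≈ G → lhs μ F ≈ lhs μ G
      lhs-cong e = +-cong (θ-cong e) (*-congˡ (+-cong (θ-cong e) (×-congʳ μ e)))
      rhs-cong : ∀ {F G} → F ≈ G → rhs μ F ≈ rhs μ G
      rhs-cong e = +-cong (*-congˡ (+-cong (+-cong (θ-cong e) (θ-cong e)) (×-congʳ μ e)))
                          (*-congˡ (+-cong (θ-cong e) (×-congʳ μ e)))

    solves-1# : θ 1# ≈ 0# → Solves 0 1#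
    solves-1# θ1≈0 = trans lhs≈0 (sym rhs≈0)
      where
      a*[0+0]≈0 : ∀ a → a * (0# + 0#) ≈ 0#
      a*[0+0]≈0 a = trans (*-congˡ (+-identityˡ 0#)) (zeroʳ a)
      lhs≈0 : lhs 0 1# ≈ 0#
      lhs≈0 = trans (+-cong θ1≈0 (trans (*-congˡ (+-congʳ θ1≈0)) (a*[0+0]≈0 Y))) (+-identityˡ 0#)
      rhs≈0 : rhs 0 1# ≈ 0#
      rhs≈0 = trans (+-cong (trans (*-congˡ (+-congʳ (trans (+-cong θ1≈0 θ1≈0) (+-identityˡ 0#)))) (a*[0+0]≈0 X))
                            (trans (*-congˡ (+-congʳ θ1≈0)) (a*[0+0]≈0 Z)))
                    (+-identityˡ 0#)

-- Series of polynomials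
open import Defs
open import Data.Nat using (ℕ; zero; suc; _+_; _*_; _∸_; _^_; _!; _≤_; _<_; z≤n; s≤s)
open import Data.Nat.DivMod using (m/n*n≡m)
import Data.Nat.Properties as ℕₚ
open import Data.Nat.Combinatorics using (_C_; k>n⇒nCk≡0; nCk≡n!/k![n-k]!; k![n∸k]!∣n!)
open import Relation.Nullary using (yes; no)
open import Data.Nat.Tactic.RingSolver using (solve-∀)
open import Relation.Binary.PropositionalEquality using (_≡_; refl; sym; trans; cong; cong₂; module ≡-Reasoning)

module P = PowerSeries ℕₚ.+-*-commutativeSemiring
module S = PowerSeries P.commutativeSemiring

Series : Set
Series = S.S

module PolySemiring = CommutativeSemiring P.commutativeSemiring
module SeriesSemiring = CommutativeSemiring S.commutativeSemiring

open import Algebra.Properties.Semiring.Mult (CommutativeSemiring.semiring ℕₚ.+-*-commutativeSemiring)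
  using () renaming (_×_ to _×ₙ_)
open import Algebra.Properties.Semiring.Mult PolySemiring.semiring using () renaming (_×_ to _×ₚ_)
open import Algebra.Properties.Semiring.Mult SeriesSemiring.semiring using () renaming (_×_ to _×ₛ_)

×ₚ-coeff : ∀ m p k → (m ×ₚ p) k ≡ m * p k
×ₚ-coeff m p k = trans (P.×-coeff m p k) (×ₙ≡* m)
  where
  ×ₙ≡* : ∀ m {x} → m ×ₙ x ≡ m * x
  ×ₙ≡* zero    = refl
  ×ₙ≡* (suc m) = cong (_ +_) (×ₙ≡* m)

scale-coeff : ∀ m F n k → (m ×ₛ F) n k ≡ m * F n k
scale-coeff m F n k = trans (S.×-coeff m F n k) (×ₚ-coeff m (F n) k)

θ-coeff : ∀ F n k → S.θ F n k ≡ n * F n k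
θ-coeff F n = ×ₚ-coeff n (F n)

∑≡sumTo : ∀ n f → P.∑ n f ≡ sumTo n f
∑≡sumTo zero    f = refl
∑≡sumTo (suc n) f = cong (_+ f (suc n)) (∑≡sumTo n f)

∑-coeff : ∀ n (F : Series) k → S.∑ n F k ≡ P.∑ n (λ i → F i k)
∑-coeff zero    F k = refl
∑-coeff (suc n) F k = cong (_+ F (suc n) k) (∑-coeff n F k)

u-zero : u 0 S.≋ S.𝟙
u-zero zero    zero    = refl
u-zero zero    (suc k) = refl
u-zero (suc n) k       = refl

u-suc : ∀ m → u (suc m) S.≋ M S.⋆ u m
u-suc m n k = sym (begin
  S.∑ n (λ i → M i P.⋆ u m (n ∸ i)) k      ≡⟨ ∑-coeff n _ k ⟩
  P.∑ n (λ i → (M i P.⋆ u m (n ∸ i)) k)    ≡⟨ P.∑-cong n (λ i _ → ∑≡sumTo k _) ⟩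
  P.∑ n (λ i → (M i ⊛ u m (n ∸ i)) k)      ≡⟨ ∑≡sumTo n _ ⟩
  u (suc m) n k                           ∎)
  where open ≡-Reasoning

Triangular : Series → Set
Triangular F = ∀ {n k} → n < k → F n k ≡ 0

⋆-triangular : ∀ {F G} → Triangular F → Triangular G → Triangular (F S.⋆ G)
⋆-triangular {F} {G} tF tG {n} {k} n<k =
  trans (∑-coeff n _ k) (P.∑-zero n (λ i i≤n → P.∑-zero k (λ a _ → term i a i≤n)))
  where
  term : ∀ i a → i ≤ n → F i a * G (n ∸ i) (k ∸ a) ≡ 0
  term i a i≤n with a ℕₚ.≤? i
  ... | yes a≤i = trans (cong (F i a *_) (tG n∸i<k∸a)) (ℕₚ.*-zeroʳ (F i a))
    where
    n∸i<k∸a : n ∸ i < k ∸ a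
    n∸i<k∸a = ℕₚ.≤-<-trans (ℕₚ.∸-monoʳ-≤ n a≤i) (ℕₚ.∸-monoˡ-< n<k (ℕₚ.≤-trans a≤i i≤n))
  ... | no  a≰i = cong (_* G (n ∸ i) (k ∸ a)) (tF (ℕₚ.≰⇒> a≰i))

M-triangular : Triangular M
M-triangular n<k rewrite k>n⇒nCk≡0 n<k = refl

u-triangular : ∀ m → Triangular (u m)
u-triangular zero    {zero}  {suc k} _   = refl
u-triangular zero    {suc n} {k}     _   = refl
u-triangular (suc m) {n}     {k}     n<k =
  trans (u-suc m n k) (⋆-triangular M-triangular (u-triangular m) n<k)

t : Poly
t = P.shift P.𝟙

-- With X = (1+t)x, Y = (1+t²)x² and Z = 2tx², Euler.Solves μ F is the equation
-- Δ·θF = μ((1+t)x − (1−t)²x²)·F of Δ^(−μ/2), with the negative terms moved across.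
xCoeff yCoeff zCoeff : Series
xCoeff = S.shift (S.C (P.𝟙 P.⊕ t))
yCoeff = S.shift (S.shift (S.C (P.𝟙 P.⊕ P.shift t)))
zCoeff = S.shift (S.shift (S.C (t P.⊕ t)))

module Euler = EulerEquation.Equation S.commutativeSemiring S.θ S.θ-cong S.θ-⋆ xCoeff yCoeff zCoeff

t-⋆ : ∀ p → t P.⋆ p P.≋ P.shift p
t-⋆ p = PolySemiring.trans (P.shift-⋆ P.𝟙 p) (P.shift-cong (PolySemiring.*-identityˡ p))

[1+t]-⋆ : ∀ p → (P.𝟙 P.⊕ t) P.⋆ p P.≋ p P.⊕ P.shift p
[1+t]-⋆ p = PolySemiring.trans (P.⋆-distribʳ p P.𝟙 t) (PolySemiring.+-cong (PolySemiring.*-identityˡ p) (t-⋆ p))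

[1+t²]-⋆ : ∀ p → (P.𝟙 P.⊕ P.shift t) P.⋆ p P.≋ p P.⊕ P.shift (P.shift p)
[1+t²]-⋆ p = PolySemiring.trans (P.⋆-distribʳ p P.𝟙 (P.shift t))
  (PolySemiring.+-cong (PolySemiring.*-identityˡ p) (PolySemiring.trans (P.shift-⋆ t p) (P.shift-cong (t-⋆ p))))

[t+t]-⋆ : ∀ p → (t P.⊕ t) P.⋆ p P.≋ P.shift p P.⊕ P.shift p
[t+t]-⋆ p = PolySemiring.trans (P.⋆-distribʳ p t t) (PolySemiring.+-cong (t-⋆ p) (t-⋆ p))

shift-C-⋆ : ∀ q F → S.shift (S.C q) S.⋆ F S.≋ S.shift (λ n → q P.⋆ F n)
shift-C-⋆ q F = SeriesSemiring.trans (S.shift-⋆ (S.C q) F) (S.shift-cong (S.C-⋆ q F))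

shift²-C-⋆ : ∀ q F → S.shift (S.shift (S.C q)) S.⋆ F S.≋ S.shift (S.shift (λ n → q P.⋆ F n))
shift²-C-⋆ q F = SeriesSemiring.trans (S.shift-⋆ _ F) (S.shift-cong (shift-C-⋆ q F))

module Recurrence (μ : ℕ) (a : Series) where

  W V : Series
  W n k = a n k * (n + μ)
  V n k = a n k * (n + n + μ)

  xTerm yTerm zTerm : Series
  xTerm = S.shift (λ n → V n P.⊕ P.shift (V n))
  yTerm = S.shift (S.shift (λ n → W n P.⊕ P.shift (P.shift (W n))))
  zTerm = S.shift (S.shift (λ n → P.shift (W n) P.⊕ P.shift (W n)))

  HoldsAt : ℕ → ℕ → Set
  HoldsAt N k = a N k * N + yTerm N k ≡ xTerm N k + zTerm N k

  private
    θa+μa≋W : S.θ a S.⊕ μ ×ₛ a S.≋ W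
    θa+μa≋W n k = trans (cong₂ _+_ (θ-coeff a n k) (scale-coeff μ a n k))
                        (trans (sym (ℕₚ.*-distribʳ-+ (a n k) n μ)) (ℕₚ.*-comm (n + μ) (a n k)))

    θa+θa+μa≋V : S.θ a S.⊕ S.θ a S.⊕ μ ×ₛ a S.≋ V
    θa+θa+μa≋V n k = trans (cong₂ _+_ (cong₂ _+_ (θ-coeff a n k) (θ-coeff a n k)) (scale-coeff μ a n k))
      (trans (cong (_+ μ * a n k) (sym (ℕₚ.*-distribʳ-+ (a n k) n n)))
        (trans (sym (ℕₚ.*-distribʳ-+ (a n k) (n + n) μ)) (ℕₚ.*-comm (n + n + μ) (a n k))))

  lhs-coeff : Euler.lhs μ a S.≋ λ N k → a N k * N + yTerm N k
  lhs-coeff = begin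
    S.θ a S.⊕ yCoeff S.⋆ (S.θ a S.⊕ μ ×ₛ a)
      ≈⟨ +-cong (λ N k → trans (θ-coeff a N k) (ℕₚ.*-comm N (a N k))) (*-congˡ {yCoeff} θa+μa≋W) ⟩
    (λ N k → a N k * N) S.⊕ yCoeff S.⋆ W
      ≈⟨ +-congˡ (shift²-C-⋆ _ W) ⟩
    (λ N k → a N k * N) S.⊕ S.shift (S.shift (λ n → (P.𝟙 P.⊕ P.shift t) P.⋆ W n))
      ≈⟨ +-congˡ (S.shift-cong (S.shift-cong (λ n → [1+t²]-⋆ (W n)))) ⟩
    (λ N k → a N k * N) S.⊕ yTerm
      ∎
    where
    open SeriesSemiring using (+-cong; +-congˡ; *-congˡ; setoid)
    open import Relation.Binary.Reasoning.Setoid setoid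

  rhs-coeff : Euler.rhs μ a S.≋ λ N k → xTerm N k + zTerm N k
  rhs-coeff = begin
    xCoeff S.⋆ (S.θ a S.⊕ S.θ a S.⊕ μ ×ₛ a) S.⊕ zCoeff S.⋆ (S.θ a S.⊕ μ ×ₛ a)
      ≈⟨ +-cong (*-congˡ {xCoeff} θa+θa+μa≋V) (*-congˡ {zCoeff} θa+μa≋W) ⟩
    xCoeff S.⋆ V S.⊕ zCoeff S.⋆ W
      ≈⟨ +-cong (shift-C-⋆ _ V) (shift²-C-⋆ _ W) ⟩
    S.shift (λ n → (P.𝟙 P.⊕ t) P.⋆ V n) S.⊕ S.shift (S.shift (λ n → (t P.⊕ t) P.⋆ W n))
      ≈⟨ +-cong (S.shift-cong (λ n → [1+t]-⋆ (V n))) (S.shift-cong (S.shift-cong (λ n → [t+t]-⋆ (W n)))) ⟩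
    xTerm S.⊕ zTerm
      ∎
    where
    open SeriesSemiring using (+-cong; +-congˡ; *-congˡ; setoid)
    open import Relation.Binary.Reasoning.Setoid setoid

  solves⇒holds : Euler.Solves μ a → ∀ N k → HoldsAt N k
  solves⇒holds sol N k = trans (sym (lhs-coeff N k)) (trans (sol N k) (rhs-coeff N k))

  holds⇒solves : (∀ N k → HoldsAt N k) → Euler.Solves μ a
  holds⇒solves rec N k = trans (lhs-coeff N k) (trans (rec N k) (sym (rhs-coeff N k)))

module ClosedForm (μ : ℕ) where

  import Data.Nat as ℕ
  open import Data.Integer as ℤ using (ℤ; +_)
  import Data.Integer.Properties as ℤₚ
  open import Data.Integer.Solver using (module +-*-Solver)
  open import Data.Nat.Induction using (<-rec)

  oddFactor : ℕ → ℕ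
  oddFactor s = suc s + s + μ

  γ δ : ℕ → ℕ
  γ zero    = 0
  γ (suc l) = suc l * oddFactor l
  δ l = (μ + l) * oddFactor l

  -- denom y = y! ∏_{s<y} (μ+2s+1)  and  numer N = μ(μ+1)⋯(μ+N−1) ∏_{s<N} (μ+2s+1)
  denom numer : ℕ → ℕ
  denom l = prodBelow l (λ s → γ (suc s))
  numer l = prodBelow l δ

  ClosedFormAt : Series → ℕ → Set
  ClosedFormAt a N = ∀ x y → x + y ≡ N → a N x * (denom x * denom y) ≡ numer N

  γℤ δℤ : ℤ → ℤ
  γℤ Y = Y ℤ.* (Y ℤ.+ Y ℤ.+ + μ ℤ.- + 1)
  δℤ L = (+ μ ℤ.+ L) ℤ.* (+ 1 ℤ.+ L ℤ.+ L ℤ.+ + μ)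

  -- A single identity over ℤ covers the cases x, y ∈ {0, 1} as well: there the terms
  -- that are absent from the recurrence carry a factor γℤ 0 = 0.
  recurrence-identityℤ : ∀ F X Y → let N = X ℤ.+ Y ℤ.- + 2 in
    (N ℤ.+ + 1 ℤ.+ (N ℤ.+ + 1) ℤ.+ + μ) ℤ.* (F ℤ.* δℤ N ℤ.* γℤ Y)
      ℤ.+ (N ℤ.+ + 1 ℤ.+ (N ℤ.+ + 1) ℤ.+ + μ) ℤ.* (F ℤ.* δℤ N ℤ.* γℤ X)
      ℤ.+ ((N ℤ.+ + μ) ℤ.* (F ℤ.* (γℤ X ℤ.* γℤ Y)) ℤ.+ (N ℤ.+ + μ) ℤ.* (F ℤ.* (γℤ X ℤ.* γℤ Y)))
    ≡ (N ℤ.+ + μ) ℤ.* (F ℤ.* (γℤ (Y ℤ.- + 1) ℤ.* γℤ Y))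
      ℤ.+ (N ℤ.+ + μ) ℤ.* (F ℤ.* (γℤ (X ℤ.- + 1) ℤ.* γℤ X))
      ℤ.+ (X ℤ.+ Y) ℤ.* (F ℤ.* δℤ N ℤ.* δℤ (N ℤ.+ + 1))
  recurrence-identityℤ F X Y = solve 4 (λ F M X Y →
      let N  = X :+ Y :- con (+ 2)
          γ′ = λ Y → Y :* (Y :+ Y :+ M :- con (+ 1))
          δ′ = λ L → (M :+ L) :* (con (+ 1) :+ L :+ L :+ M)
          s₁ = N :+ con (+ 1) :+ (N :+ con (+ 1)) :+ M
          s₀ = N :+ M
      in s₁ :* (F :* δ′ N :* γ′ Y) :+ s₁ :* (F :* δ′ N :* γ′ X)
           :+ (s₀ :* (F :* (γ′ X :* γ′ Y)) :+ s₀ :* (F :* (γ′ X :* γ′ Y)))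
         := s₀ :* (F :* (γ′ (Y :- con (+ 1)) :* γ′ Y)) :+ s₀ :* (F :* (γ′ (X :- con (+ 1)) :* γ′ X))
            :+ (X :+ Y) :* (F :* δ′ N :* δ′ (N :+ con (+ 1))))
    refl F (+ μ) X Y
    where open +-*-Solver

  private
    infixl 6 _⟨+⟩_
    infixl 7 _⟨*⟩_

    ⌜_⌝ : ∀ m → + m ≡ + m
    ⌜ m ⌝ = refl

    _⟨+⟩_ : ∀ {m n M N} → + m ≡ M → + n ≡ N → + (m + n) ≡ M ℤ.+ N
    _⟨+⟩_ {m} {n} p q = trans (ℤₚ.pos-+ m n) (cong₂ ℤ._+_ p q)

    _⟨*⟩_ : ∀ {m n M N} → + m ≡ M → + n ≡ N → + (m * n) ≡ M ℤ.* N
    _⟨*⟩_ {m} {n} p q = trans (ℤₚ.pos-* m n) (cong₂ ℤ._*_ p q)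

    castγ : ∀ y → + γ y ≡ γℤ (+ y)
    castγ zero    = refl
    castγ (suc l) = trans (⌜ suc l ⌝ ⟨*⟩ (⌜ suc l ⌝ ⟨+⟩ ⌜ l ⌝ ⟨+⟩ ⌜ μ ⌝)) (rearrange (+ l) (+ μ))
      where
      rearrange : ∀ L M → (+ 1 ℤ.+ L) ℤ.* (+ 1 ℤ.+ L ℤ.+ L ℤ.+ M)
                        ≡ (+ 1 ℤ.+ L) ℤ.* (+ 1 ℤ.+ L ℤ.+ (+ 1 ℤ.+ L) ℤ.+ M ℤ.- + 1)
      rearrange = solve 2 (λ L M → (con (+ 1) :+ L) :* (con (+ 1) :+ L :+ L :+ M)
                              := (con (+ 1) :+ L) :* (con (+ 1) :+ L :+ (con (+ 1) :+ L) :+ M :- con (+ 1))) refl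
        where open +-*-Solver

    castγγ : ∀ y → + (γ (ℕ.pred y) * γ y) ≡ γℤ (+ y ℤ.- + 1) ℤ.* γℤ (+ y)
    castγγ zero    = sym (ℤₚ.*-zeroʳ (γℤ (+ 0 ℤ.- + 1)))
    castγγ (suc l) = castγ l ⟨*⟩ castγ (suc l)

    castδ : ∀ {l L} → + l ≡ L → + δ l ≡ δℤ L
    castδ p = (⌜ μ ⌝ ⟨+⟩ p) ⟨*⟩ (cong (ℤ._+_ (+ 1)) p ⟨+⟩ p ⟨+⟩ ⌜ μ ⌝)

  recurrence-identity : ∀ {n} x y F → x + y ≡ suc (suc n) → let s₁ = suc n + suc n + μ ; s₀ = n + μ in
    s₁ * (F * δ n * γ y) + s₁ * (F * δ n * γ x) + (s₀ * (F * (γ x * γ y)) + s₀ * (F * (γ x * γ y)))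
      ≡ s₀ * (F * (γ (ℕ.pred y) * γ y)) + s₀ * (F * (γ (ℕ.pred x) * γ x)) + suc (suc n) * (F * δ n * δ (suc n))
  recurrence-identity {n} x y F x+y≡N =
    ℤₚ.+-injective (trans castˡ (trans (recurrence-identityℤ (+ F) (+ x) (+ y)) (sym castʳ)))
    where
    castN+2 : + suc (suc n) ≡ + x ℤ.+ + y
    castN+2 = trans (cong +_ (sym x+y≡N)) (ℤₚ.pos-+ x y)
    castN : + n ≡ + x ℤ.+ + y ℤ.- + 2
    castN = cong (ℤ._- + 2) castN+2
    castN+1 : + suc n ≡ + x ℤ.+ + y ℤ.- + 2 ℤ.+ + 1
    castN+1 = trans (cong +_ (ℕₚ.+-comm 1 n)) (castN ⟨+⟩ ⌜ 1 ⌝)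
    s₁ = castN+1 ⟨+⟩ castN+1 ⟨+⟩ ⌜ μ ⌝
    s₀ = castN ⟨+⟩ ⌜ μ ⌝
    castˡ = s₁ ⟨*⟩ (⌜ F ⌝ ⟨*⟩ castδ castN ⟨*⟩ castγ y) ⟨+⟩ s₁ ⟨*⟩ (⌜ F ⌝ ⟨*⟩ castδ castN ⟨*⟩ castγ x)
            ⟨+⟩ (s₀ ⟨*⟩ (⌜ F ⌝ ⟨*⟩ (castγ x ⟨*⟩ castγ y)) ⟨+⟩ s₀ ⟨*⟩ (⌜ F ⌝ ⟨*⟩ (castγ x ⟨*⟩ castγ y)))
    castʳ = s₀ ⟨*⟩ (⌜ F ⌝ ⟨*⟩ castγγ y) ⟨+⟩ s₀ ⟨*⟩ (⌜ F ⌝ ⟨*⟩ castγγ x)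
            ⟨+⟩ castN+2 ⟨*⟩ (⌜ F ⌝ ⟨*⟩ castδ castN ⟨*⟩ castδ castN+1)

  denom-nonZero : ∀ l → ℕ.NonZero (denom l)
  denom-nonZero zero    = _
  denom-nonZero (suc l) = ℕₚ.m*n≢0 (denom l) (γ (suc l)) {{denom-nonZero l}}

  module _ (a : Series) (tri : Triangular a) where

    open Recurrence μ a

    private
      denom₂ : ℕ → ℕ → ℕ
      denom₂ x y = denom x * denom y

      peelʳ : ∀ p {q} x y → p * denom₂ x y ≡ q → p * denom₂ x (suc y) ≡ q * γ (suc y)
      peelʳ p x y e = trans (reassoc p (denom x) (denom y) (γ (suc y))) (cong (_* γ (suc y)) e)
        where
        reassoc : ∀ p dx dy c → p * (dx * (dy * c)) ≡ p * (dx * dy) * c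
        reassoc = solve-∀

      peelˡ : ∀ p {q} x y → p * denom₂ x y ≡ q → p * denom₂ (suc x) y ≡ q * γ (suc x)
      peelˡ p x y e = trans (reassoc p (denom x) (denom y) (γ (suc x))) (cong (_* γ (suc x)) e)
        where
        reassoc : ∀ p dx dy c → p * (dx * c * dy) ≡ p * (dx * dy) * c
        reassoc = solve-∀

      -- a at the neighbours (x, y−1), (x−1, y), (x, y−2), (x−2, y), (x−1, y−1) of (x, y), times denom₂ x y
      neighbour-y : ∀ {n} x y → ClosedFormAt a n → x + y ≡ suc n → a n x * denom₂ x y ≡ numer n * γ y
      neighbour-y {n} x zero _ e rewrite ℕₚ.+-identityʳ x | e | tri (ℕₚ.n<1+n n) = sym (ℕₚ.*-zeroʳ (numer n))
      neighbour-y {n} x (suc y) cf e = peelʳ (a n x) x y (cf x y (ℕₚ.suc-injective (trans (sym (ℕₚ.+-suc x y)) e)))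

      neighbour-x : ∀ {n} x y → ClosedFormAt a n → x + y ≡ suc n → P.shift (a n) x * denom₂ x y ≡ numer n * γ x
      neighbour-x {n} zero _ _ _ = sym (ℕₚ.*-zeroʳ (numer n))
      neighbour-x {n} (suc x) y cf e = peelˡ (a n x) x y (cf x y (ℕₚ.suc-injective e))

      neighbour-yy : ∀ {n} x y → ClosedFormAt a n → x + y ≡ suc (suc n) →
                 a n x * denom₂ x y ≡ numer n * (γ (ℕ.pred y) * γ y)
      neighbour-yy {n} x zero _ e rewrite ℕₚ.+-identityʳ x | e | tri (ℕₚ.m<n⇒m<1+n (ℕₚ.n<1+n n)) = sym (ℕₚ.*-zeroʳ (numer n))
      neighbour-yy {n} x (suc y) cf e =
        trans (peelʳ (a n x) x y (neighbour-y x y cf (ℕₚ.suc-injective (trans (sym (ℕₚ.+-suc x y)) e)))) (ℕₚ.*-assoc (numer n) _ _)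

      neighbour-xx : ∀ {n} x y → ClosedFormAt a n → x + y ≡ suc (suc n) →
                 P.shift (P.shift (a n)) x * denom₂ x y ≡ numer n * (γ (ℕ.pred x) * γ x)
      neighbour-xx {n} zero _ _ _ = sym (ℕₚ.*-zeroʳ (numer n))
      neighbour-xx {n} (suc x) y cf e =
        trans (peelˡ (P.shift (a n) x) x y (neighbour-x x y cf (ℕₚ.suc-injective e))) (ℕₚ.*-assoc (numer n) _ _)

      neighbour-xy : ∀ {n} x y → ClosedFormAt a n → x + y ≡ suc (suc n) →
                 P.shift (a n) x * denom₂ x y ≡ numer n * (γ x * γ y)
      neighbour-xy {n} x zero _ e rewrite ℕₚ.+-identityʳ x | e | tri (ℕₚ.n<1+n n) =
        sym (trans (cong (numer n *_) (ℕₚ.*-zeroʳ (γ (suc (suc n))))) (ℕₚ.*-zeroʳ (numer n)))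
      neighbour-xy {n} x (suc y) cf e =
        trans (peelʳ (P.shift (a n) x) x y (neighbour-x x y cf (ℕₚ.suc-injective (trans (sym (ℕₚ.+-suc x y)) e))))
              (ℕₚ.*-assoc (numer n) _ _)

      shift-scale : ∀ p s x → P.shift (λ k → p k * s) x ≡ P.shift p x * s
      shift-scale p s zero    = refl
      shift-scale p s (suc x) = refl

      shift²-scale : ∀ p s x → P.shift (P.shift (λ k → p k * s)) x ≡ P.shift (P.shift p) x * s
      shift²-scale p s zero    = refl
      shift²-scale p s (suc x) = shift-scale p s x

    ClosedFormBelow : ℕ → Set
    ClosedFormBelow N = ∀ {r} → r ℕ.< N → ClosedFormAt a r

    -- Given the closed form below N, the recurrence at (N, x) holds iff the closed form does at (x, y).
    lower-terms : ∀ {N x y} → ClosedFormBelow N → x + y ≡ N →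
                  (xTerm N x + zTerm N x) * denom₂ x y ≡ yTerm N x * denom₂ x y + N * numer N
    lower-terms {zero}  {zero}  {zero}  _ _ = refl
    lower-terms {suc zero} {x} {y} below x+y≡1 = begin
      (V 0 x + P.shift (V 0) x + 0) * denom₂ x y
        ≡⟨ cong (λ z → (V 0 x + z + 0) * denom₂ x y) (shift-scale (a 0) μ x) ⟩
      (a 0 x * μ + P.shift (a 0) x * μ + 0) * denom₂ x y
        ≡⟨ distrib (a 0 x) (P.shift (a 0) x) μ (denom₂ x y) ⟩
      μ * (a 0 x * denom₂ x y) + μ * (P.shift (a 0) x * denom₂ x y)
        ≡⟨ cong₂ (λ p q → μ * p + μ * q) (neighbour-y x y cf₀ x+y≡1) (neighbour-x x y cf₀ x+y≡1) ⟩
      μ * (1 * γ y) + μ * (1 * γ x)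
        ≡⟨ one-step x y x+y≡1 ⟩
      1 * numer 1
        ∎
      where
      open ≡-Reasoning
      cf₀ : ClosedFormAt a 0
      cf₀ = below (s≤s z≤n)
      distrib : ∀ p q m G → (p * m + q * m + 0) * G ≡ m * (p * G) + m * (q * G)
      distrib = solve-∀
      one-step : ∀ x y → x + y ≡ 1 → μ * (1 * γ y) + μ * (1 * γ x) ≡ 1 * numer 1
      one-step zero (suc zero) _ = identity μ
        where
        identity : ∀ m → m * (1 * (1 * (1 + 0 + m))) + m * (1 * 0) ≡ 1 * (1 * ((m + 0) * (1 + 0 + m)))
        identity = solve-∀
      one-step (suc zero) zero _ = identity μ
        where
        identity : ∀ m → m * (1 * 0) + m * (1 * (1 * (1 + 0 + m))) ≡ 1 * (1 * ((m + 0) * (1 + 0 + m)))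
        identity = solve-∀
    lower-terms {suc (suc n)} {x} {y} below x+y≡N = begin
      (V (suc n) x + P.shift (V (suc n)) x + (P.shift (W n) x + P.shift (W n) x)) * G
        ≡⟨ cong₂ (λ p q → (V (suc n) x + p + (q + q)) * G) (shift-scale (a (suc n)) s₁ x) (shift-scale (a n) s₀ x) ⟩
      (a (suc n) x * s₁ + P.shift (a (suc n)) x * s₁ + (P.shift (a n) x * s₀ + P.shift (a n) x * s₀)) * G
        ≡⟨ distribˡ (a (suc n) x) (P.shift (a (suc n)) x) (P.shift (a n) x) s₁ s₀ G ⟩
      s₁ * (a (suc n) x * G) + s₁ * (P.shift (a (suc n)) x * G) + (s₀ * (P.shift (a n) x * G) + s₀ * (P.shift (a n) x * G))
        ≡⟨ cong₂ _+_ (cong₂ (λ p q → s₁ * p + s₁ * q) (neighbour-y x y cf₁ x+y≡N) (neighbour-x x y cf₁ x+y≡N))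
                     (cong (λ p → s₀ * p + s₀ * p) (neighbour-xy x y cf₀ x+y≡N)) ⟩
      s₁ * (numer (suc n) * γ y) + s₁ * (numer (suc n) * γ x) + (s₀ * (numer n * (γ x * γ y)) + s₀ * (numer n * (γ x * γ y)))
        ≡⟨ recurrence-identity x y (numer n) x+y≡N ⟩
      s₀ * (numer n * (γ (ℕ.pred y) * γ y)) + s₀ * (numer n * (γ (ℕ.pred x) * γ x)) + suc (suc n) * numer (suc (suc n))
        ≡⟨ cong (λ z → z + suc (suc n) * numer (suc (suc n)))
                (sym (cong₂ (λ p q → s₀ * p + s₀ * q) (neighbour-yy x y cf₀ x+y≡N) (neighbour-xx x y cf₀ x+y≡N))) ⟩
      s₀ * (a n x * G) + s₀ * (P.shift (P.shift (a n)) x * G) + suc (suc n) * numer (suc (suc n))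
        ≡⟨ cong (_+ suc (suc n) * numer (suc (suc n))) (distribʳ (a n x) (P.shift (P.shift (a n)) x) s₀ G) ⟩
      (a n x * s₀ + P.shift (P.shift (a n)) x * s₀) * G + suc (suc n) * numer (suc (suc n))
        ≡⟨ cong (λ z → (W n x + z) * G + suc (suc n) * numer (suc (suc n))) (sym (shift²-scale (a n) s₀ x)) ⟩
      (W n x + P.shift (P.shift (W n)) x) * G + suc (suc n) * numer (suc (suc n))
        ∎
      where
      open ≡-Reasoning
      G = denom₂ x y
      s₁ = suc n + suc n + μ
      s₀ = n + μ
      cf₁ : ClosedFormAt a (suc n)
      cf₁ = below ℕₚ.≤-refl
      cf₀ : ClosedFormAt a n
      cf₀ = below (ℕₚ.m<n⇒m<1+n ℕₚ.≤-refl)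
      distribˡ : ∀ p q r m₁ m₀ G → (p * m₁ + q * m₁ + (r * m₀ + r * m₀)) * G
                                   ≡ m₁ * (p * G) + m₁ * (q * G) + (m₀ * (r * G) + m₀ * (r * G))
      distribˡ = solve-∀
      distribʳ : ∀ p q m G → m * (p * G) + m * (q * G) ≡ (p * m + q * m) * G
      distribʳ = solve-∀

    holds-above-diagonal : ∀ {N k} → N ℕ.< k → HoldsAt N k
    holds-above-diagonal {zero}        {suc k}       _ rewrite tri {0} {suc k} (s≤s z≤n) = refl
    holds-above-diagonal {suc zero}    {suc (suc k)} _
      rewrite tri {1} {suc (suc k)} (s≤s (s≤s z≤n)) | tri {0} {suc (suc k)} (s≤s z≤n) | tri {0} {suc k} (s≤s z≤n) = refl
    holds-above-diagonal {suc zero}    {suc zero}    (s≤s ())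
    holds-above-diagonal {suc (suc n)} {suc (suc k)} (s≤s (s≤s n<k))
      rewrite tri {suc (suc n)} (s≤s (s≤s n<k)) | tri {suc n} (s≤s (ℕₚ.m<n⇒m<1+n n<k)) | tri {suc n} (s≤s n<k)
            | tri {n} (ℕₚ.m<n⇒m<1+n (ℕₚ.m<n⇒m<1+n n<k)) | tri {n} (ℕₚ.m<n⇒m<1+n n<k) | tri {n} n<k = refl

    closedForm⇒holds : (∀ N → ClosedFormAt a N) → ∀ N k → HoldsAt N k
    closedForm⇒holds cf N k with k ℕₚ.≤? N
    ... | no  k≰N = holds-above-diagonal (ℕₚ.≰⇒> k≰N)
    ... | yes k≤N = ℕₚ.*-cancelʳ-≡ _ _ G {{G≢0}} (begin
      (a N k * N + yTerm N k) * G       ≡⟨ distrib (a N k) N (yTerm N k) G ⟩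
      N * (a N k * G) + yTerm N k * G   ≡⟨ cong (λ z → N * z + yTerm N k * G) (cf N k (N ∸ k) k+[N∸k]≡N) ⟩
      N * numer N + yTerm N k * G       ≡⟨ ℕₚ.+-comm (N * numer N) _ ⟩
      yTerm N k * G + N * numer N       ≡⟨ lower-terms (λ {r} _ → cf r) k+[N∸k]≡N ⟨
      (xTerm N k + zTerm N k) * G       ∎)
      where
      open ≡-Reasoning
      G = denom₂ k (N ∸ k)
      G≢0 : ℕ.NonZero G
      G≢0 = ℕₚ.m*n≢0 (denom k) (denom (N ∸ k)) {{denom-nonZero k}} {{denom-nonZero (N ∸ k)}}
      k+[N∸k]≡N = ℕₚ.m+[n∸m]≡n k≤N
      distrib : ∀ p N Y G → (p * N + Y) * G ≡ N * (p * G) + Y * G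
      distrib = solve-∀

    holds⇒closedForm : (∀ N k → HoldsAt N k) → a 0 0 ≡ 1 → ∀ N → ClosedFormAt a N
    holds⇒closedForm holds a₀₀≡1 = <-rec (ClosedFormAt a) step
      where
      step : ∀ N → ClosedFormBelow N → ClosedFormAt a N
      step zero    _     zero zero _ = trans (ℕₚ.*-identityʳ (a 0 0)) a₀₀≡1
      step (suc N) below x    y    e = ℕₚ.*-cancelˡ-≡ _ _ (suc N) (ℕₚ.+-cancelʳ-≡ (yTerm (suc N) x * G) _ _ (begin
        suc N * (a (suc N) x * G) + yTerm (suc N) x * G   ≡⟨ distrib (a (suc N) x) (suc N) (yTerm (suc N) x) G ⟨
        (a (suc N) x * suc N + yTerm (suc N) x) * G       ≡⟨ cong (_* G) (holds (suc N) x) ⟩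
        (xTerm (suc N) x + zTerm (suc N) x) * G           ≡⟨ lower-terms below e ⟩
        yTerm (suc N) x * G + suc N * numer (suc N)       ≡⟨ ℕₚ.+-comm _ (suc N * numer (suc N)) ⟩
        suc N * numer (suc N) + yTerm (suc N) x * G       ∎))
        where
        open ≡-Reasoning
        G = denom₂ x y
        distrib : ∀ p N Y G → (p * N + Y) * G ≡ N * (p * G) + Y * G
        distrib = solve-∀

prodBelow-cong : ∀ k {f g} → (∀ j → j < k → f j ≡ g j) → prodBelow k f ≡ prodBelow k g
prodBelow-cong zero    f≡g = refl
prodBelow-cong (suc k) f≡g = cong₂ _*_ (prodBelow-cong k (λ j j<k → f≡g j (ℕₚ.m<n⇒m<1+n j<k))) (f≡g k ℕₚ.≤-refl)

prodBelow-* : ∀ k f g → prodBelow k (λ j → f j * g j) ≡ prodBelow k f * prodBelow k g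
prodBelow-* zero    f g = refl
prodBelow-* (suc k) f g = trans (cong (_* (f k * g k)) (prodBelow-* k f g)) (interchange (prodBelow k f) (prodBelow k g) (f k) (g k))
  where
  interchange : ∀ a b c d → a * b * (c * d) ≡ a * c * (b * d)
  interchange = solve-∀

prodBelow-top : ∀ {k n} f → k ≤ n → prodBelow n f ≡ prodBelow (n ∸ k) f * prodBelow k (λ j → f (n ∸ suc j))
prodBelow-top {zero}  f _ = sym (ℕₚ.*-identityʳ _)
prodBelow-top {suc k} {suc n} f (s≤s k≤n) = begin
  prodBelow (suc n) f                                              ≡⟨ prodBelow-top f (ℕₚ.m≤n⇒m≤1+n k≤n) ⟩
  prodBelow (suc n ∸ k) f * prodBelow k (λ j → f (suc n ∸ suc j))   ≡⟨ cong (λ m → prodBelow m f * top) (ℕₚ.+-∸-assoc 1 k≤n) ⟩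
  prodBelow (n ∸ k) f * f (n ∸ k) * top                             ≡⟨ rotate (prodBelow (n ∸ k) f) (f (n ∸ k)) top ⟩
  prodBelow (n ∸ k) f * (prodBelow k (λ j → f (n ∸ j)) * f (n ∸ k)) ∎
  where
  open ≡-Reasoning
  top = prodBelow k (λ j → f (n ∸ j))
  rotate : ∀ a b c → a * b * c ≡ a * (c * b)
  rotate = solve-∀

prodBelow-suc : ∀ n → prodBelow n suc ≡ n !
prodBelow-suc zero    = refl
prodBelow-suc (suc n) = trans (cong (_* suc n) (prodBelow-suc n)) (ℕₚ.*-comm (n !) (suc n))

C-factorials : ∀ {n k} → k ≤ n → (n C k) * (k ! * (n ∸ k) !) ≡ n !
C-factorials {n} {k} k≤n rewrite nCk≡n!/k![n-k]! k≤n =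
  m/n*n≡m {{ℕₚ.m*n≢0 (k !) ((n ∸ k) !) {{k ℕₚ.!≢0}} {{(n ∸ k) ℕₚ.!≢0}}}} (k![n∸k]!∣n! k≤n)

-- M and its powers
module CF₁ = ClosedForm 1

-- for μ = 1 the factors are γ (suc l) = δ l = 2 (l + 1)²
denom₁ : ∀ l → CF₁.denom l ≡ l ! * l ! * 2 ^ l
denom₁ zero    = refl
denom₁ (suc l) = trans (cong (_* CF₁.γ (suc l)) (denom₁ l)) (rearrange (l !) (2 ^ l) l)
  where
  rearrange : ∀ f p l → f * f * p * (suc l * (suc l + l + 1)) ≡ (f + l * f) * (f + l * f) * (2 * p)
  rearrange = solve-∀

M-closedForm : ∀ N → CF₁.ClosedFormAt M N
M-closedForm .(x + y) x y refl = begin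
  c * c * (CF₁.denom x * CF₁.denom y)                  ≡⟨ cong₂ (λ p q → c * c * (p * q)) (denom₁ x) (denom₁ y) ⟩
  c * c * (x ! * x ! * 2 ^ x * (y ! * y ! * 2 ^ y))     ≡⟨ rearrange c (x !) (y !) (2 ^ x) (2 ^ y) ⟩
  c * (x ! * y !) * (c * (x ! * y !)) * (2 ^ x * 2 ^ y) ≡⟨ cong₂ (λ p q → p * p * q) c-factorials (sym (ℕₚ.^-distribˡ-+-* 2 x y)) ⟩
  (x + y) ! * (x + y) ! * 2 ^ (x + y)                  ≡⟨ denom₁ (x + y) ⟨
  CF₁.numer (x + y)                                    ∎
  where
  open ≡-Reasoning
  c = (x + y) C x
  c-factorials : c * (x ! * y !) ≡ (x + y) !
  c-factorials = trans (cong (λ z → c * (x ! * z !)) (sym (ℕₚ.m+n∸m≡n x y))) (C-factorials (ℕₚ.m≤m+n x y))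
  rearrange : ∀ c X Y p q → c * c * (X * X * p * (Y * Y * q)) ≡ c * (X * Y) * (c * (X * Y)) * (p * q)
  rearrange = solve-∀

M-solves : Euler.Solves 1 M
M-solves = Recurrence.holds⇒solves 1 M (CF₁.closedForm⇒holds M M-triangular M-closedForm)

u-solves : ∀ m → Euler.Solves m (u m)
u-solves zero    = Euler.solves-resp 0 (SeriesSemiring.sym u-zero) (Euler.solves-1# θ𝟙≋𝟘)
  where
  θ𝟙≋𝟘 : S.θ S.𝟙 S.≋ S.𝟘
  θ𝟙≋𝟘 zero    k = θ-coeff S.𝟙 0 k
  θ𝟙≋𝟘 (suc n) k = trans (θ-coeff S.𝟙 (suc n) k) (ℕₚ.*-zeroʳ (suc n))
u-solves (suc m) = Euler.solves-resp (suc m) (SeriesSemiring.sym (u-suc m)) (Euler.solves-* {1} {m} M-solves (u-solves m))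

u-origin : ∀ m → u m 0 0 ≡ 1
u-origin zero    = refl
u-origin (suc m) rewrite u-origin m = refl

u-closedForm : ∀ m N → ClosedForm.ClosedFormAt m (u m) N
u-closedForm m = ClosedForm.holds⇒closedForm m (u m) (u-triangular m)
                   (Recurrence.solves⇒holds m (u m) (u-solves m)) (u-origin m)

module ProductFormula (m : ℕ) where

  open ClosedForm (suc m)

  oddProduct : ℕ → ℕ
  oddProduct l = prodBelow l oddFactor

  denom≡ : ∀ l → denom l ≡ l ! * oddProduct l
  denom≡ l = trans (prodBelow-* l suc oddFactor) (cong (_* oddProduct l) (prodBelow-suc l))

  rising-binomial : ∀ l → prodBelow l (λ s → suc m + s) ≡ ((l + m) C m) * l !
  rising-binomial l = ℕₚ.*-cancelʳ-≡ _ _ (m !) {{m ℕₚ.!≢0}} (trans (rising-factorial l) (sym binomial))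
    where
    rising-factorial : ∀ l → prodBelow l (λ s → suc m + s) * m ! ≡ (l + m) !
    rising-factorial zero    = ℕₚ.*-identityˡ (m !)
    rising-factorial (suc l) = trans (rotate (prodBelow l (λ s → suc m + s)) (suc m + l) (m !))
      (cong₂ _*_ (cong suc (ℕₚ.+-comm m l)) (rising-factorial l))
      where
      rotate : ∀ a b c → a * b * c ≡ b * (a * c)
      rotate = solve-∀
    binomial : ((l + m) C m) * l ! * m ! ≡ (l + m) !
    binomial = trans (trans (ℕₚ.*-assoc ((l + m) C m) (l !) (m !)) (cong (((l + m) C m) *_) (ℕₚ.*-comm (l !) (m !))))
      (trans (cong (λ z → ((l + m) C m) * (m ! * z !)) (sym (ℕₚ.m+n∸n≡m l m))) (C-factorials (ℕₚ.m≤n+m m l)))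

  numer≡ : ∀ l → numer l ≡ ((l + m) C m) * l ! * oddProduct l
  numer≡ l = trans (prodBelow-* l (λ s → suc m + s) oddFactor) (cong (_* oddProduct l) (rising-binomial l))

  oddFactor-flip : ∀ {j n} → j < n → 2 * n + suc m ∸ 1 ∸ 2 * j ≡ oddFactor (n ∸ suc j)
  oddFactor-flip {j} {n} j<n = begin
    2 * n + suc m ∸ 1 ∸ 2 * j                       ≡⟨ cong (λ l → 2 * l + suc m ∸ 1 ∸ 2 * j) (ℕₚ.m+[n∸m]≡n j<n) ⟨
    2 * (suc j + r) + suc m ∸ 1 ∸ 2 * j             ≡⟨ cong (λ l → l ∸ 1 ∸ 2 * j) (rearrange j r m) ⟩
    suc (2 * j + oddFactor r) ∸ 1 ∸ 2 * j           ≡⟨ ℕₚ.m+n∸m≡n (2 * j) (oddFactor r) ⟩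
    oddFactor r                                     ∎
    where
    open ≡-Reasoning
    r = n ∸ suc j
    rearrange : ∀ j r m → 2 * (suc j + r) + suc m ≡ suc (2 * j + (suc r + r + suc m))
    rearrange = solve-∀

  oddProduct-top : ∀ {k n} → k ≤ n → oddProduct n ≡ oddProduct (n ∸ k) * prodBelow k (λ j → 2 * n + suc m ∸ 1 ∸ 2 * j)
  oddProduct-top {k} {n} k≤n = trans (prodBelow-top oddFactor k≤n)
    (cong (oddProduct (n ∸ k) *_) (prodBelow-cong k (λ j j<k → sym (oddFactor-flip (ℕₚ.<-≤-trans j<k k≤n)))))

  oddProduct-reverse : ∀ k → oddProduct k ≡ prodBelow k (λ j → 2 * k + suc m ∸ 1 ∸ 2 * j)
  oddProduct-reverse k = trans (oddProduct-top {k} ℕₚ.≤-refl)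
    (trans (cong (λ l → oddProduct l * Pk) (ℕₚ.n∸n≡0 k)) (ℕₚ.*-identityˡ Pk))
    where
    Pk = prodBelow k (λ j → 2 * k + suc m ∸ 1 ∸ 2 * j)

  product-formula : ∀ {a n k} → k ≤ n → ClosedFormAt a n →
    a n k * prodBelow k (λ j → 2 * k + suc m ∸ 1 ∸ 2 * j)
      ≡ ((n + m) C m) * (n C k) * prodBelow k (λ j → 2 * n + suc m ∸ 1 ∸ 2 * j)
  product-formula {a} {n} {k} k≤n cf =
    ℕₚ.*-cancelʳ-≡ _ _ (k ! * denom y) {{ℕₚ.m*n≢0 (k !) (denom y) {{k ℕₚ.!≢0}} {{denom-nonZero y}}}} (begin
      a n k * Pk * (k ! * denom y)                   ≡⟨ rearrangeˡ (a n k) Pk (k !) (denom y) ⟩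
      a n k * (k ! * Pk * denom y)                   ≡⟨ cong (λ z → a n k * (k ! * z * denom y)) (oddProduct-reverse k) ⟨
      a n k * (k ! * oddProduct k * denom y)         ≡⟨ cong (λ z → a n k * (z * denom y)) (denom≡ k) ⟨
      a n k * (denom k * denom y)                    ≡⟨ cf k y (ℕₚ.m+[n∸m]≡n k≤n) ⟩
      numer n                                        ≡⟨ numer≡ n ⟩
      ((n + m) C m) * n ! * oddProduct n             ≡⟨ cong₂ (λ p q → ((n + m) C m) * p * q) (C-factorials k≤n) (sym (oddProduct-top k≤n)) ⟨
      ((n + m) C m) * ((n C k) * (k ! * y !)) * (oddProduct y * Pn)
        ≡⟨ rearrangeʳ ((n + m) C m) (n C k) Pn (k !) (y !) (oddProduct y) ⟨
      ((n + m) C m) * (n C k) * Pn * (k ! * (y ! * oddProduct y))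
        ≡⟨ cong (λ z → ((n + m) C m) * (n C k) * Pn * (k ! * z)) (denom≡ y) ⟨
      ((n + m) C m) * (n C k) * Pn * (k ! * denom y) ∎)
    where
    open ≡-Reasoning
    y = n ∸ k
    Pk = prodBelow k (λ j → 2 * k + suc m ∸ 1 ∸ 2 * j)
    Pn = prodBelow k (λ j → 2 * n + suc m ∸ 1 ∸ 2 * j)
    rearrangeˡ : ∀ a p f d → a * p * (f * d) ≡ a * (f * p * d)
    rearrangeˡ = solve-∀
    rearrangeʳ : ∀ c b p f g o → c * b * p * (f * (g * o)) ≡ c * (b * (f * g)) * (o * p)
    rearrangeʳ = solve-∀

theorem5 : (m : ℕ) → 1 ≤ m → (n k : ℕ) →
    u m n k * prodBelow k (λ j → 2 * k + m ∸ 1 ∸ 2 * j)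
      ≡ ((n + m ∸ 1) C (m ∸ 1)) * (n C k) * prodBelow k (λ j → 2 * n + m ∸ 1 ∸ 2 * j)
theorem5 (suc m) _ n k with k ℕₚ.≤? n
... | yes k≤n = trans (ProductFormula.product-formula m {u (suc m)} k≤n (u-closedForm (suc m) n))
                      (cong (λ l → ((l ∸ 1) C m) * (n C k) * prodBelow k (λ j → 2 * n + suc m ∸ 1 ∸ 2 * j))
                            (sym (ℕₚ.+-suc n m)))
... | no  k≰n rewrite u-triangular (suc m) (ℕₚ.≰⇒> k≰n) | k>n⇒nCk≡0 (ℕₚ.≰⇒> k≰n)
              | ℕₚ.*-zeroʳ ((n + suc m ∸ 1) C m) = refl
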